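{- Work intuitionistically. An overt locale $X$ is an o-algebra if and only if it coincides with its own smallest overt, strongly dense sublocale, i.e. if and only if the map $R_X(y)=\bigvee\{x\in\Omega X\mid \forall z\in\Omega X\ (\mathrm{Pos}_X(z\wedge x)\le\mathrm{Pos}_X(z\wedge y))\}$ is the identity on $\Omega X$.
   Context: A locale $X$ is given by its frame $\Omega X$. $\Omega$ is the frame of truth values (power set of a singleton); $\Omega!_X:\Omega\to\Omega X$ is $\Omega!_X(p)=\bigvee\{x\in\Omega X\mid x=1\text{ and }p=1\}$. $X$ is overt if $\Omega!_X$ has a left adjoint $\mathrm{Pos}_X:\Omega X\to\Omega$. A nucleus on $\Omega X$ is a monotone, binary-meet-preserving map $j$ with $x\le j(x)=j(j(x))$; it determines a sublocale $X_j$ with frame $\mathrm{Fix}(j)$, and sublocales are ordered by inclusion of these frames. A sublocale $X_j$ is strongly dense if $j\circ\Omega!_X=\Omega!_X$. An overlap algebra (o-algebra) is an overt locale $X$ such that for all $x,y\in\Omega X$: if $\mathrm{Pos}_X(z\wedge x)\le\mathrm{Pos}_X(z\wedge y)$ for all $z\in\Omega X$, then $x\le y$. -}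

module Defs where

open import Level using (Level; suc; _⊔_)
open import Data.Product using (Σ; _×_; _,_; proj₁)
open import Function using (_⇔_)

-- Truth values are the types
-- in Set ℓ (propositions, ordered by implication); joins exist for all
-- families indexed by types in Set ℓ (impredicative reading: the carrier and
-- the index types live in the same universe, as in a topos).
record Frame (ℓ : Level) : Set (suc ℓ) where
  infix 4 _≤_ _≈_
  infixr 7 _∧_
  field
    Carrier : Set ℓ
    _≤_     : Carrier → Carrier → Set ℓ
    ≤-refl  : ∀ {x} → x ≤ x
    ≤-trans : ∀ {x y z} → x ≤ y → y ≤ z → x ≤ z
    ⊤       : Carrier
    ⊤-max   : ∀ {x} → x ≤ ⊤
    _∧_     : Carrier → Carrier → Carrier
    ∧-lb₁   : ∀ {x y} → x ∧ y ≤ x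
    ∧-lb₂   : ∀ {x y} → x ∧ y ≤ y
    ∧-glb   : ∀ {x y z} → z ≤ x → z ≤ y → z ≤ x ∧ y
    ⋁       : {I : Set ℓ} → (I → Carrier) → Carrier
    ⋁-ub    : ∀ {I : Set ℓ} (f : I → Carrier) (i : I) → f i ≤ ⋁ f
    ⋁-lub   : ∀ {I : Set ℓ} (f : I → Carrier) {z} → (∀ i → f i ≤ z) → ⋁ f ≤ z
    distrib : ∀ {I : Set ℓ} (x : Carrier) (f : I → Carrier) →
              x ∧ ⋁ f ≤ ⋁ (λ i → x ∧ f i)

  _≈_ : Carrier → Carrier → Set ℓ
  x ≈ y = (x ≤ y) × (y ≤ x)

module _ {ℓ : Level} (X : Frame ℓ) where
  open Frame X

  Ω! : Set ℓ → Carrier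
  Ω! p = ⋁ {I = Σ Carrier (λ x → (x ≈ ⊤) × p)} proj₁

  record Overt : Set (suc ℓ) where
    field
      Pos     : Carrier → Set ℓ
      Pos-adj : ∀ (x : Carrier) (p : Set ℓ) → (Pos x → p) ⇔ (x ≤ Ω! p)

  IsOAlgebra : Overt → Set ℓ
  IsOAlgebra ov = ∀ (x y : Carrier) →
    (∀ (z : Carrier) → Pos (z ∧ x) → Pos (z ∧ y)) → x ≤ y
    where open Overt ov

  R : Overt → Carrier → Carrier
  R ov y = ⋁ {I = Σ Carrier (λ x → ∀ (z : Carrier) → Pos (z ∧ x) → Pos (z ∧ y))} proj₁
    where open Overt ov

  record IsNucleus (j : Carrier → Carrier) : Set ℓ where
    field
      mono       : ∀ {x y} → x ≤ y → j x ≤ j y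
      pres-∧     : ∀ x y → j (x ∧ y) ≈ (j x ∧ j y)
      inflate    : ∀ x → x ≤ j x
      idempotent : ∀ x → j (j x) ≈ j x

  -- Ω!_{X_j}(p), computed in the frame Fix(j) (whose joins are j ∘ ⋁ and
  -- whose top is ⊤):  ⋁_{Fix j} { x ∈ Fix(j) | x = 1 and p }
  Ω!-sub : (Carrier → Carrier) → Set ℓ → Carrier
  Ω!-sub j p = j (⋁ {I = Σ Carrier (λ x → (j x ≈ x) × (x ≈ ⊤) × p)} proj₁)

  OvertSub : (Carrier → Carrier) → Set (suc ℓ)
  OvertSub j = Σ (Carrier → Set ℓ) λ Posj →
    ∀ (x : Carrier) → j x ≈ x → ∀ (p : Set ℓ) → (Posj x → p) ⇔ (x ≤ Ω!-sub j p)

  StronglyDense : (Carrier → Carrier) → Set (suc ℓ)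
  StronglyDense j = ∀ (p : Set ℓ) → j (Ω! p) ≈ Ω! p

  -- X coincides with its smallest overt strongly dense sublocale:
  -- X is contained in every overt strongly dense sublocale X_j,
  -- i.e. Fix(j) = ΩX (every open is j-fixed).
  IsSmallestOSD : Set (suc ℓ)
  IsSmallestOSD = ∀ (j : Carrier → Carrier) → IsNucleus j → OvertSub j →
    StronglyDense j → ∀ (x : Carrier) → j x ≈ x

-- Write x ⊑ y when ∀ z. Pos(z ∧ x) ≤ Pos(z ∧ y); X is an o-algebra exactly when ⊑ implies ≤,
-- and R y is the largest x with x ⊑ y, which gives the second equivalence at once.
-- The relation ⊑ is a preorder compatible with meets, which makes R a nucleus; R is
-- strongly dense, and every strongly dense sublocale of an overt locale is overt.
-- Conversely every strongly dense nucleus j satisfies j x ⊑ x, because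
-- z ∧ j x ≤ j (z ∧ x) ≤ j (Ω! (Pos (z ∧ x))) = Ω! (Pos (z ∧ x)).
-- So R is the smallest overt strongly dense sublocale, and X equals it iff R is the identity.
module Submission where

open import Defs
open import Level using (Level)
open import Data.Product using (_×_; Σ; _,_; proj₁; proj₂)
open import Function using (_⇔_; mk⇔; id; _∘′_)
open import Function.Bundles using (module Equivalence)

module MeetProperties {ℓ : Level} (X : Frame ℓ) where
  open Frame X

  ∧-monoʳ : ∀ {z x y} → x ≤ y → z ∧ x ≤ z ∧ y
  ∧-monoʳ x≤y = ∧-glb ∧-lb₁ (≤-trans ∧-lb₂ x≤y)

  ∧-assocˡ : ∀ {x y z} → x ∧ (y ∧ z) ≤ (x ∧ y) ∧ z
  ∧-assocˡ = ∧-glb (∧-glb ∧-lb₁ (≤-trans ∧-lb₂ ∧-lb₁)) (≤-trans ∧-lb₂ ∧-lb₂)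

  ∧-assocʳ : ∀ {x y z} → (x ∧ y) ∧ z ≤ x ∧ (y ∧ z)
  ∧-assocʳ = ∧-glb (≤-trans ∧-lb₁ ∧-lb₁) (∧-glb (≤-trans ∧-lb₁ ∧-lb₂) ∧-lb₂)

  ∧-swapʳ : ∀ {x y z} → (x ∧ y) ∧ z ≤ (x ∧ z) ∧ y
  ∧-swapʳ = ∧-glb (∧-glb (≤-trans ∧-lb₁ ∧-lb₁) ∧-lb₂) (≤-trans ∧-lb₁ ∧-lb₂)

module OvertProperties {ℓ : Level} (X : Frame ℓ) (ov : Overt X) where
  open Frame X
  open Overt ov
  open MeetProperties X

  ⇒≤Ω! : ∀ {x p} → (Pos x → p) → x ≤ Ω! X p
  ⇒≤Ω! {x} {p} = Equivalence.to (Pos-adj x p)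

  ≤Ω!⇒ : ∀ {x p} → x ≤ Ω! X p → Pos x → p
  ≤Ω!⇒ {x} {p} = Equivalence.from (Pos-adj x p)

  ≤Ω!Pos : ∀ {x} → x ≤ Ω! X (Pos x)
  ≤Ω!Pos = ⇒≤Ω! id

  Pos-Ω! : ∀ {p} → Pos (Ω! X p) → p
  Pos-Ω! = ≤Ω!⇒ ≤-refl

  Pos-mono : ∀ {x y} → x ≤ y → Pos x → Pos y
  Pos-mono x≤y = ≤Ω!⇒ (≤-trans x≤y ≤Ω!Pos)

  Pos-⋁ : ∀ {I : Set ℓ} (f : I → Carrier) → Pos (⋁ f) → Σ I (λ i → Pos (f i))
  Pos-⋁ f = ≤Ω!⇒ (⋁-lub f (λ i → ⇒≤Ω! (i ,_)))

  stronglyDense⇒overtSub : ∀ {j} → IsNucleus X j → StronglyDense X j → OvertSub X j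
  stronglyDense⇒overtSub {j} isNucleus dense = Pos , λ x _ p → mk⇔
    (λ Pos⇒p → ≤-trans (⇒≤Ω! Pos⇒p) (≤-trans (Ω!≤⋁fixed p) (inflate _)))
    (λ x≤Ω!-sub → ≤Ω!⇒ (≤-trans x≤Ω!-sub (≤-trans (mono (⋁fixed≤Ω! p)) (proj₁ (dense p)))))
    where
    open IsNucleus isNucleus

    FixedTop : Set ℓ → Set ℓ
    FixedTop p = Σ Carrier (λ x → (j x ≈ x) × (x ≈ ⊤) × p)

    Ω!≤⋁fixed : ∀ p → Ω! X p ≤ ⋁ {I = FixedTop p} proj₁
    Ω!≤⋁fixed p = ⋁-lub _ λ { (x , x≈⊤ , holds) →
      ≤-trans (proj₁ x≈⊤) (⋁-ub {I = FixedTop p} proj₁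
        (⊤ , (⊤-max , inflate ⊤) , (≤-refl , ≤-refl) , holds)) }

    ⋁fixed≤Ω! : ∀ p → ⋁ {I = FixedTop p} proj₁ ≤ Ω! X p
    ⋁fixed≤Ω! p = ⋁-lub _ λ { (x , _ , x≈⊤ , holds) →
      ⋁-ub {I = Σ Carrier (λ x → (x ≈ ⊤) × p)} proj₁ (x , x≈⊤ , holds) }

  infix 4 _⊑_
  _⊑_ : Carrier → Carrier → Set ℓ
  x ⊑ y = ∀ (z : Carrier) → Pos (z ∧ x) → Pos (z ∧ y)

  ⊑-refl : ∀ {x} → x ⊑ x
  ⊑-refl _ = id

  ⊑-trans : ∀ {x y w} → x ⊑ y → y ⊑ w → x ⊑ w
  ⊑-trans x⊑y y⊑w z = y⊑w z ∘′ x⊑y z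

  ≤⇒⊑ : ∀ {x y} → x ≤ y → x ⊑ y
  ≤⇒⊑ x≤y _ = Pos-mono (∧-monoʳ x≤y)

  ∧-⊑ : ∀ {x x′ y y′} → x ⊑ x′ → y ⊑ y′ → x ∧ y ⊑ x′ ∧ y′
  ∧-⊑ {x} {x′} {y} {y′} x⊑x′ y⊑y′ z Pos[z∧x∧y] =
    Pos-mono ∧-assocʳ (y⊑y′ (z ∧ x′) (Pos-mono ∧-swapʳ
      (x⊑x′ (z ∧ y) (Pos-mono (≤-trans ∧-assocˡ ∧-swapʳ) Pos[z∧x∧y]))))

  ⊑⇒Pos : ∀ {x y} → x ⊑ y → Pos x → Pos y
  ⊑⇒Pos x⊑y Pos[x] = Pos-mono ∧-lb₂ (x⊑y ⊤ (Pos-mono (∧-glb ⊤-max ≤-refl) Pos[x]))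

  stronglyDense⇒⊑ : ∀ {j} → IsNucleus X j → StronglyDense X j → ∀ x → j x ⊑ x
  stronglyDense⇒⊑ {j} isNucleus dense x z = ≤Ω!⇒ z∧jx≤Ω!Pos
    where
    open IsNucleus isNucleus
    z∧jx≤Ω!Pos : z ∧ j x ≤ Ω! X (Pos (z ∧ x))
    z∧jx≤Ω!Pos =
      ≤-trans (∧-glb (≤-trans ∧-lb₁ (inflate z)) ∧-lb₂)
        (≤-trans (proj₂ (pres-∧ z x)) (≤-trans (mono ≤Ω!Pos) (proj₁ (dense _))))

  private
    Below : Carrier → Set ℓ
    Below y = Σ Carrier (λ x → x ⊑ y)

  ⊑⇒≤R : ∀ {x y} → x ⊑ y → x ≤ R X ov y
  ⊑⇒≤R {x} {y} x⊑y = ⋁-ub {I = Below y} proj₁ (x , x⊑y)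

  R-least : ∀ {y w} → (∀ {x} → x ⊑ y → x ≤ w) → R X ov y ≤ w
  R-least {y} below⇒≤w = ⋁-lub {I = Below y} proj₁ (λ (_ , x⊑y) → below⇒≤w x⊑y)

  -- Pos (z ∧ ⋁ S) splits, through the frame distributive law, into some Pos (z ∧ x) with x ∈ S.
  R⊑ : ∀ y → R X ov y ⊑ y
  R⊑ y z Pos[z∧Ry] with Pos-⋁ _ (Pos-mono (distrib z proj₁) Pos[z∧Ry])
  ... | ((_ , x⊑y) , Pos[z∧x]) = x⊑y z Pos[z∧x]

  R-mono : ∀ {x y} → x ≤ y → R X ov x ≤ R X ov y
  R-mono x≤y = ⊑⇒≤R (⊑-trans (R⊑ _) (≤⇒⊑ x≤y))

  R-isNucleus : IsNucleus X (R X ov)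
  R-isNucleus = record
    { mono       = R-mono
    ; pres-∧     = λ x y → ∧-glb (R-mono ∧-lb₁) (R-mono ∧-lb₂) , ⊑⇒≤R (∧-⊑ (R⊑ x) (R⊑ y))
    ; inflate    = λ _ → ⊑⇒≤R ⊑-refl
    ; idempotent = λ x → ⊑⇒≤R (⊑-trans (R⊑ (R X ov x)) (R⊑ x)) , ⊑⇒≤R ⊑-refl
    }

  R-stronglyDense : StronglyDense X (R X ov)
  R-stronglyDense p = ⇒≤Ω! (Pos-Ω! ∘′ ⊑⇒Pos (R⊑ (Ω! X p))) , ⊑⇒≤R ⊑-refl

  isOAlgebra⇔R≈id : IsOAlgebra X ov ⇔ (∀ y → R X ov y ≈ y)
  isOAlgebra⇔R≈id = mk⇔
    (λ oAlgebra y → R-least (oAlgebra _ y) , ⊑⇒≤R ⊑-refl)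
    (λ R≈id x y x⊑y → ≤-trans (⊑⇒≤R x⊑y) (proj₁ (R≈id y)))

  isOAlgebra⇔isSmallestOSD : IsOAlgebra X ov ⇔ IsSmallestOSD X
  isOAlgebra⇔isSmallestOSD = mk⇔
    (λ oAlgebra j isNucleus _ dense x →
      oAlgebra (j x) x (stronglyDense⇒⊑ isNucleus dense x) , IsNucleus.inflate isNucleus x)
    (λ smallest → Equivalence.from isOAlgebra⇔R≈id
      (smallest (R X ov) R-isNucleus
        (stronglyDense⇒overtSub R-isNucleus R-stronglyDense) R-stronglyDense))

corollary3p6 : ∀ {ℓ : Level} (X : Frame ℓ) (ov : Overt X) →
    (IsOAlgebra X ov ⇔ IsSmallestOSD X)
    × (IsOAlgebra X ov ⇔ (∀ (y : Frame.Carrier X) → Frame._≈_ X (R X ov y) y))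
corollary3p6 X ov = isOAlgebra⇔isSmallestOSD , isOAlgebra⇔R≈id
  where open OvertProperties X ov
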